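{- For every $n \in \mathbb{N}$ there exists a convex set $A \subset \mathbb{R}$ with $|A| = n$ such that the difference set $A - A = \{a - b : a, b \in A\}$ contains a convex subset $S$ with $|S| \geq C n^2$, where $C > 0$ is an absolute constant (independent of $n$).
   Context: A finite set $A = \{a_1 < a_2 < \dots < a_n\} \subset \mathbb{R}$ is called convex if its consecutive differences are strictly increasing, i.e. $a_{i+1} - a_i > a_i - a_{i-1}$ for all $i = 2, \dots, n-1$. -}

module Defs where

open import Data.Integer using (ℤ; _-_; _<_)
open import Data.List using (List; []; _∷_)
open import Data.List.Membership.Propositional using (_∈_)
open import Data.Product using (_×_; ∃-syntax)
open import Data.Unit using (⊤)
open import Relation.Binary.PropositionalEquality using (_≡_)

-- A finite set of integers, listed a₁ < a₂ < … < aₙ, is "convex" when it is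
-- strictly increasing and consecutive differences are strictly increasing.
StrictlyIncreasing : List ℤ → Set
StrictlyIncreasing []            = ⊤
StrictlyIncreasing (x ∷ [])      = ⊤
StrictlyIncreasing (x ∷ y ∷ xs)  = (x < y) × StrictlyIncreasing (y ∷ xs)

ConvexDiffs : List ℤ → Set
ConvexDiffs (x ∷ y ∷ z ∷ xs) = (y - x < z - y) × ConvexDiffs (y ∷ z ∷ xs)
ConvexDiffs _                = ⊤

Convex : List ℤ → Set
Convex xs = StrictlyIncreasing xs × ConvexDiffs xs

InDiffSet : List ℤ → ℤ → Set
InDiffSet A s = ∃[ a ] ∃[ b ] (a ∈ A × b ∈ A × s ≡ a - b)

{-# OPTIONS --safe #-}
module Submission where

-- Take A = {f y : K ≤ y < K + n} with f y = H y² + y³.  A point (d , y) stands for the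
-- difference f (y + d) − f y = H ((y + d)² − y²) + ((y + d)³ − y³) ∈ A − A.  Along a diagonal
-- (d fixed, y increasing) the quadratic part grows by 2d per step while the cubic part is
-- strictly convex; jumping from y = (d + 1) t on diagonal d to y = d t on diagonal d + 1 makes
-- the quadratic part grow by 2d + 1.  Hence along a path of such steps the quadratic gaps
-- 2d, 2d + 1, 2d + 2, … never decrease, and where they stay equal the cubic part is strictly
-- convex; since H exceeds twice the cubic part, the differences form a convex set.  With
-- K = 6m² and t_d = ⌊K/d⌋ + 1, the path through the diagonals m ≤ d ≤ 2m keeps K ≤ y and
-- y + d ≤ K + 10m + 1, and every diagonal after the first contributes at least m + 2 points:
-- n ≈ 12m elements yield (m + 1)² convex differences.

open import Defs

module _ where
  open import Data.Nat.Base
  open import Data.Nat.Properties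
  open import Data.Nat.DivMod
    using (m≡m%n+[m/n]*n; m%n<n; m/n*n≤m; m*n/n≡m; /-monoˡ-≤; /-monoʳ-≤)
  open import Data.Nat.Tactic.RingSolver using (solve-∀)
  open import Data.Integer.Base as ℤ using (ℤ; +_; +<+)
  import Data.Integer.Properties as ℤ
  import Data.Integer.Tactic.RingSolver as ℤ
  open import Data.List.Base using (List; []; _∷_; map; applyUpTo; length)
  open import Data.List.Properties using (length-map; length-applyUpTo)
  open import Data.List.Membership.Propositional using (_∈_)
  open import Data.List.Membership.Propositional.Properties using (∈-map⁺; ∈-applyUpTo⁺)
  open import Data.List.Relation.Unary.All as All using (All; []; _∷_)
  import Data.List.Relation.Unary.All.Properties as All
  open import Data.List.Relation.Unary.Linked using (Linked; []; [-]; _∷_)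
  open import Data.List.Relation.Unary.Linked.Properties using (applyUpTo⁺₁)
  open import Data.Product.Base using (_×_; _,_; ∃-syntax)
  open import Data.Sum.Base using (_⊎_; inj₁; inj₂)
  open import Data.Unit.Base using (⊤; tt)
  open import Function.Base using (_∘_)
  open import Relation.Binary.PropositionalEquality

  midpoint⇒gap< : ∀ {x y z} → y + y < x + z → + y ℤ.- + x ℤ.< + z ℤ.- + y
  midpoint⇒gap< {x} {y} {z} y+y<x+z =
    subst₂ ℤ._<_ (left (+ y) (+ x)) (right (+ y) (+ x) (+ z))
      (ℤ.+-monoˡ-< (ℤ.- (+ y ℤ.+ + x))
        (subst₂ ℤ._<_ (ℤ.pos-+ y y) (ℤ.pos-+ x z) (+<+ y+y<x+z)))
    where
    left : ∀ a b → (a ℤ.+ a) ℤ.+ ℤ.- (a ℤ.+ b) ≡ a ℤ.- b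
    left = ℤ.solve-∀
    right : ∀ a b c → (b ℤ.+ c) ℤ.+ ℤ.- (a ℤ.+ b) ≡ c ℤ.- a
    right = ℤ.solve-∀

  +[m+n]-+m≡+n : ∀ m n → + (m + n) ℤ.- + m ≡ + n
  +[m+n]-+m≡+n m n = begin
    + (m + n) ℤ.- + m  ≡⟨ ℤ.m-n≡m⊖n (m + n) m ⟩
    (m + n) ℤ.⊖ m      ≡⟨ ℤ.⊖-≥ (m≤m+n m n) ⟩
    + (m + n ∸ m)      ≡⟨ cong +_ (m+n∸m≡n m n) ⟩
    + n                ∎
    where open ≡-Reasoning

  module _ {P : Set} {Q : P → Set} {R : P → P → Set} (v : P → ℕ) where

    strictlyIncreasing-map : (∀ {p q} → Q p → R p q → v p < v q) →
                             ∀ {ps} → All Q ps → Linked R ps →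
                             StrictlyIncreasing (map (+_ ∘ v) ps)
    strictlyIncreasing-map increasing []         []       = tt
    strictlyIncreasing-map increasing (_ ∷ [])   [-]      = tt
    strictlyIncreasing-map increasing (qp ∷ qs) (r ∷ rs) =
      +<+ (increasing qp r) , strictlyIncreasing-map increasing qs rs

    convexDiffs-map : (∀ {p q r} → Q q → R p q → R q r → v q + v q < v p + v r) →
                      ∀ {ps} → All Q ps → Linked R ps → ConvexDiffs (map (+_ ∘ v) ps)
    convexDiffs-map midpoint []            []         = tt
    convexDiffs-map midpoint (_ ∷ [])      [-]        = tt
    convexDiffs-map midpoint (_ ∷ _ ∷ [])  (_ ∷ [-])  = tt
    convexDiffs-map midpoint {p ∷ q ∷ r ∷ _} (_ ∷ qs@(qq ∷ _)) (pq ∷ rs@(qr ∷ _)) =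
      midpoint⇒gap< {v p} {v q} {v r} (midpoint qq pq qr) , convexDiffs-map midpoint qs rs

    convex-map : (∀ {p q} → Q p → R p q → v p < v q) →
                 (∀ {p q r} → Q q → R p q → R q r → v q + v q < v p + v r) →
                 ∀ {ps} → All Q ps → Linked R ps → Convex (map (+_ ∘ v) ps)
    convex-map increasing midpoint qs rs =
      strictlyIncreasing-map increasing qs rs , convexDiffs-map midpoint qs rs

  gaps⇒midpoint-≡ : ∀ {a₀ a₁ a₂ g} → a₁ ≡ a₀ + g → a₂ ≡ a₁ + g → a₁ + a₁ ≡ a₀ + a₂
  gaps⇒midpoint-≡ {a₀} {g = g} refl refl = lemma a₀ g
    where
    lemma : ∀ a g → (a + g) + (a + g) ≡ a + ((a + g) + g)
    lemma = solve-∀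

  gaps⇒midpoint-< : ∀ {a₀ a₁ a₂ g g′} → a₁ ≡ a₀ + g → a₂ ≡ a₁ + g′ → g < g′ →
                    a₁ + a₁ < a₀ + a₂
  gaps⇒midpoint-< {a₀} {a₁} {g = g} {g′} a₁≡ refl g<g′ = begin-strict
    a₁ + a₁        ≡⟨ gaps⇒midpoint-≡ {a₀} {g = g} a₁≡ refl ⟩
    a₀ + (a₁ + g)  <⟨ +-monoʳ-< a₀ (+-monoʳ-< a₁ g<g′) ⟩
    a₀ + (a₁ + g′) ∎
    where open ≤-Reasoning

  scaled-< : ∀ {H a b x} y → x < H → a < b → H * a + x < H * b + y
  scaled-< {H} {a} {b} {x} y x<H a<b = begin-strict
    H * a + x  <⟨ +-monoʳ-< (H * a) x<H ⟩
    H * a + H  ≡⟨ +-comm (H * a) H ⟩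
    H + H * a  ≡⟨ *-suc H a ⟨
    H * suc a  ≤⟨ *-monoʳ-≤ H a<b ⟩
    H * b      ≤⟨ m≤m+n (H * b) y ⟩
    H * b + y  ∎
    where open ≤-Reasoning

  scaled-<-lex : ∀ {H a b x y} → x < H → a < b ⊎ (a ≡ b × x < y) → H * a + x < H * b + y
  scaled-<-lex {y = y} x<H (inj₁ a<b)          = scaled-< y x<H a<b
  scaled-<-lex {H} {a} x<H (inj₂ (refl , x<y)) = +-monoʳ-< (H * a) x<y

  scaled-sum : ∀ H a x b y → (H * a + x) + (H * b + y) ≡ H * (a + b) + (x + y)
  scaled-sum = solve-∀

  Point : Set
  Point = ℕ × ℕ

  quadraticPart : Point → ℕ
  quadraticPart (d , y) = 2 * (d * y) + d * d

  cubicPart : Point → ℕ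
  cubicPart (d , y) = d * (3 * (y * y) + 3 * (y * d) + d * d)

  cubicPart-≤ : ∀ d y → cubicPart (d , y) ≤ (y + d) * (y + d) * (y + d)
  cubicPart-≤ d y = subst (cubicPart (d , y) ≤_) (sym (cube-shift d y)) (m≤n+m _ (y * y * y))
    where
    cube-shift : ∀ d y → (y + d) * (y + d) * (y + d) ≡
                         y * y * y + d * (3 * (y * y) + 3 * (y * d) + d * d)
    cube-shift = solve-∀

  cubicPart-along-convex : ∀ d y →
    cubicPart (suc d , suc y) + cubicPart (suc d , suc y) <
    cubicPart (suc d , y) + cubicPart (suc d , suc (suc y))
  cubicPart-along-convex d y =
    subst (cubicPart (suc d , suc y) + cubicPart (suc d , suc y) <_)
      (sym (second-difference (suc d) y)) (m<m+n _ z<s)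
    where
    second-difference : ∀ e y →
      e * (3 * (y * y) + 3 * (y * e) + e * e) +
      e * (3 * ((2 + y) * (2 + y)) + 3 * ((2 + y) * e) + e * e) ≡
      (e * (3 * ((1 + y) * (1 + y)) + 3 * ((1 + y) * e) + e * e) +
       e * (3 * ((1 + y) * (1 + y)) + 3 * ((1 + y) * e) + e * e)) + 6 * e
    second-difference = solve-∀

  data Step : Point → Point → Set where
    along : ∀ {d y} → Step (suc d , y) (suc d , suc y)
    turn  : ∀ {d y y′} → suc d * y′ ≡ d * y → Step (d , y) (suc d , y′)

  mainGap : ∀ {p q} → Step p q → ℕ
  mainGap (along {d}) = 2 * suc d
  mainGap (turn {d} _) = suc (2 * d)

  quadraticPart-step : ∀ {p q} (s : Step p q) → quadraticPart q ≡ quadraticPart p + mainGap s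
  quadraticPart-step (along {d} {y}) = lemma d y
    where
    lemma : ∀ d y → 2 * (suc d * suc y) + suc d * suc d ≡
                    (2 * (suc d * y) + suc d * suc d) + 2 * suc d
    lemma = solve-∀
  quadraticPart-step (turn {d} {y} {y′} eq) = begin
    2 * (suc d * y′) + suc d * suc d     ≡⟨ cong (λ z → 2 * z + suc d * suc d) eq ⟩
    2 * (d * y) + suc d * suc d          ≡⟨ lemma d (d * y) ⟩
    (2 * (d * y) + d * d) + suc (2 * d)  ∎
    where
    open ≡-Reasoning
    lemma : ∀ d z → 2 * z + suc d * suc d ≡ (2 * z + d * d) + suc (2 * d)
    lemma = solve-∀

  quadraticPart-< : ∀ {p q} → Step p q → quadraticPart p < quadraticPart q
  quadraticPart-< {p} s =
    subst (quadraticPart p <_) (sym (quadraticPart-step s)) (m<m+n _ (positive s))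
    where
    positive : ∀ {p q} (s : Step p q) → 0 < mainGap s
    positive along    = z<s
    positive (turn _) = z<s

  midpoint-lex : ∀ {p q r} → Step p q → Step q r →
    quadraticPart q + quadraticPart q < quadraticPart p + quadraticPart r ⊎
    (quadraticPart q + quadraticPart q ≡ quadraticPart p + quadraticPart r ×
     cubicPart q + cubicPart q < cubicPart p + cubicPart r)
  midpoint-lex s@(along {d} {y}) s′@along =
    inj₂ (gaps⇒midpoint-≡ (quadraticPart-step s) (quadraticPart-step s′) ,
          cubicPart-along-convex d y)
  midpoint-lex s@along s′@(turn _) =
    inj₁ (gaps⇒midpoint-< (quadraticPart-step s) (quadraticPart-step s′) (n<1+n _))
  midpoint-lex s@(turn {d} _) s′@along =
    inj₁ (gaps⇒midpoint-< (quadraticPart-step s) (quadraticPart-step s′)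
           (≤-reflexive (sym (*-suc 2 d))))
  midpoint-lex s@(turn {d} _) s′@(turn _) =
    inj₁ (gaps⇒midpoint-< (quadraticPart-step s) (quadraticPart-step s′)
           (s<s (*-monoʳ-< 2 (n<1+n d))))

  inDiffSet-zero : ∀ {A a} → a ∈ A → InDiffSet A (+ 0)
  inDiffSet-zero {a = a} a∈A = a , a , a∈A , a∈A , sym (ℤ.+-inverseʳ a)

  module _ (H : ℕ) where

    cubic : ℕ → ℕ
    cubic y = H * (y * y) + y * y * y

    difference : Point → ℕ
    difference p = H * quadraticPart p + cubicPart p

    cubic-shift : ∀ d y → cubic (y + d) ≡ cubic y + difference (d , y)
    cubic-shift d y = lemma H d y
      where
      lemma : ∀ H d y → H * ((y + d) * (y + d)) + (y + d) * (y + d) * (y + d) ≡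
                        (H * (y * y) + y * y * y) +
                        (H * (2 * (d * y) + d * d) + d * (3 * (y * y) + 3 * (y * d) + d * d))
      lemma = solve-∀

    cubic-< : ∀ y → cubic y < cubic (suc y)
    cubic-< y = subst (cubic y <_) (sym (lemma H y)) (m<m+n _ z<s)
      where
      lemma : ∀ H y → H * ((1 + y) * (1 + y)) + (1 + y) * (1 + y) * (1 + y) ≡
                      (H * (y * y) + y * y * y) + (1 + (H * (2 * y + 1) + 3 * (y * y) + 3 * y))
      lemma = solve-∀

    cubic-midpoint : ∀ y → cubic (suc y) + cubic (suc y) < cubic y + cubic (suc (suc y))
    cubic-midpoint y =
      subst (cubic (suc y) + cubic (suc y) <_) (sym (lemma H y)) (m<m+n _ z<s)
      where
      lemma : ∀ H y →
        (H * (y * y) + y * y * y) + (H * ((2 + y) * (2 + y)) + (2 + y) * (2 + y) * (2 + y)) ≡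
        ((H * ((1 + y) * (1 + y)) + (1 + y) * (1 + y) * (1 + y)) +
         (H * ((1 + y) * (1 + y)) + (1 + y) * (1 + y) * (1 + y))) + (6 + (2 * H + 6 * y))
      lemma = solve-∀

    Small : Point → Set
    Small p = cubicPart p + cubicPart p < H

    difference-< : ∀ {p q} → Small p → Step p q → difference p < difference q
    difference-< {q = q} small s =
      scaled-< (cubicPart q) (≤-<-trans (m≤m+n _ _) small) (quadraticPart-< s)

    difference-midpoint : ∀ {p q r} → Small q → Step p q → Step q r →
                          difference q + difference q < difference p + difference r
    difference-midpoint {p} {q} {r} small s s′ = begin-strict
      difference q + difference q
        ≡⟨ scaled-sum H (quadraticPart q) (cubicPart q) (quadraticPart q) (cubicPart q) ⟩
      H * (quadraticPart q + quadraticPart q) + (cubicPart q + cubicPart q)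
        <⟨ scaled-<-lex small (midpoint-lex s s′) ⟩
      H * (quadraticPart p + quadraticPart r) + (cubicPart p + cubicPart r)
        ≡⟨ scaled-sum H (quadraticPart p) (cubicPart p) (quadraticPart r) (cubicPart r) ⟨
      difference p + difference r ∎
      where open ≤-Reasoning

    cubicImage : ℕ → ℕ → List ℤ
    cubicImage K n = map (+_ ∘ cubic) (applyUpTo (_+_ K) n)

    cubicImage-convex : ∀ K n → Convex (cubicImage K n)
    cubicImage-convex K n =
      convex-map {Q = λ _ → ⊤} {R = λ y y′ → suc y ≡ y′} cubic
        (λ { {y} _ refl → cubic-< y }) (λ { {y} _ refl refl → cubic-midpoint y })
        (All.universal (λ _ → tt) _) (applyUpTo⁺₁ (_+_ K) n (λ {i} _ → sym (+-suc K i)))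

    length-cubicImage : ∀ K n → length (cubicImage K n) ≡ n
    length-cubicImage K n = trans (length-map _ (applyUpTo (_+_ K) n)) (length-applyUpTo _ n)

    ∈-cubicImage : ∀ {K n y} → K ≤ y → y < K + n → + cubic y ∈ cubicImage K n
    ∈-cubicImage {K} {n} {y} K≤y y<K+n =
      subst (λ z → + cubic z ∈ cubicImage K n) (m+[n∸m]≡n K≤y)
        (∈-map⁺ (+_ ∘ cubic) (∈-applyUpTo⁺ (_+_ K) y∸K<n))
      where
      y∸K<n : y ∸ K < n
      y∸K<n = subst (y ∸ K <_) (m+n∸m≡n K n) (∸-monoˡ-< y<K+n K≤y)

    inDiffSet-difference : ∀ {K n d y} → K ≤ y → y + d < K + n →
                           InDiffSet (cubicImage K n) (+ difference (d , y))
    inDiffSet-difference {d = d} {y} K≤y y+d<K+n =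
      + cubic (y + d) , + cubic y ,
      ∈-cubicImage (≤-trans K≤y (m≤m+n y d)) y+d<K+n ,
      ∈-cubicImage K≤y (≤-<-trans (m≤m+n y d) y+d<K+n) ,
      sym (trans (cong (λ a → + a ℤ.- + cubic y) (cubic-shift d y))
                 (+[m+n]-+m≡+n (cubic y) (difference (d , y))))

  module DiagonalWalk (m : ℕ) .{{_ : NonZero m}} where

    K : ℕ
    K = 6 * m * m

    -- Diagonal d is walked from y = pivot (d − 1) up to y = blockEnd d, then left by a turn.
    -- pivot d = d t_d is the least multiple of d above K, so every diagonal starts just above K
    -- and is about K/d ≥ 3m long.
    t : (d : ℕ) .{{_ : NonZero d}} → ℕ
    t d = suc (K / d)

    pivot : (d : ℕ) .{{_ : NonZero d}} → ℕ
    pivot d = d * t d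

    blockEnd : (d : ℕ) .{{_ : NonZero d}} → ℕ
    blockEnd d = suc d * t d

    top : ℕ
    top = K + suc (10 * m)

    mutual
      walk : (d : ℕ) .{{_ : NonZero d}} (y gap turns : ℕ) → List Point
      walk d y gap turns = (d , y) ∷ onward d y gap turns

      onward : (d : ℕ) .{{_ : NonZero d}} (y gap turns : ℕ) → List Point
      onward d y (suc gap) turns       = walk d (suc y) gap turns
      onward d y zero      (suc turns) = walk (suc d) (pivot d) (blockEnd (suc d) ∸ pivot d) turns
      onward d y zero      zero        = []

    path : List Point
    path = walk m (blockEnd m) 0 m

    pivot-above : ∀ d .{{_ : NonZero d}} → K < pivot d
    pivot-above d = begin-strict
      K                  ≡⟨ m≡m%n+[m/n]*n K d ⟩
      K % d + K / d * d  <⟨ +-monoˡ-< (K / d * d) (m%n<n K d) ⟩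
      d + K / d * d      ≡⟨ cong (_+_ d) (*-comm (K / d) d) ⟩
      d + d * (K / d)    ≡⟨ *-suc d (K / d) ⟨
      pivot d            ∎
      where open ≤-Reasoning

    pivot-below : ∀ d .{{_ : NonZero d}} → pivot d ≤ d + K
    pivot-below d = begin
      pivot d          ≡⟨ *-suc d (K / d) ⟩
      d + d * (K / d)  ≡⟨ cong (_+_ d) (*-comm d (K / d)) ⟩
      d + K / d * d    ≤⟨ +-monoʳ-≤ d (m/n*n≤m K d) ⟩
      d + K            ∎
      where open ≤-Reasoning

    t-upper : ∀ d .{{_ : NonZero d}} → m ≤ d → t d ≤ suc (6 * m)
    t-upper d m≤d = s≤s (begin
      K / d  ≤⟨ /-monoʳ-≤ K m≤d ⟩
      K / m  ≡⟨ m*n/n≡m (6 * m) m ⟩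
      6 * m  ∎)
      where open ≤-Reasoning

    t-lower : ∀ d .{{_ : NonZero d}} → d ≤ 2 * m → suc (3 * m) ≤ t d
    t-lower d d≤2m = s≤s (begin
      3 * m                ≡⟨ m*n/n≡m (3 * m) d ⟨
      3 * m * d / d        ≤⟨ /-monoˡ-≤ d (*-monoʳ-≤ (3 * m) d≤2m) ⟩
      3 * m * (2 * m) / d  ≡⟨ cong (λ k → k / d) (lemma m) ⟩
      K / d                ∎)
      where
      open ≤-Reasoning
      lemma : ∀ m → 3 * m * (2 * m) ≡ 6 * m * m
      lemma = solve-∀

    blockEnd-bound : ∀ d .{{_ : NonZero d}} → m ≤ d → d ≤ 2 * m → blockEnd d + d ≤ top
    blockEnd-bound d m≤d d≤2m = begin
      t d + pivot d + d                  ≤⟨ +-mono-≤ (+-mono-≤ (t-upper d m≤d) pivot≤) d≤2m ⟩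
      suc (6 * m) + (2 * m + K) + 2 * m  ≡⟨ lemma m K ⟩
      top                                ∎
      where
      open ≤-Reasoning
      pivot≤ : pivot d ≤ 2 * m + K
      pivot≤ = ≤-trans (pivot-below d) (+-monoˡ-≤ K d≤2m)
      lemma : ∀ m k → suc (6 * m) + (2 * m + k) + 2 * m ≡ k + suc (10 * m)
      lemma = solve-∀

    block-long : ∀ d .{{_ : NonZero d}} → suc d ≤ 2 * m → pivot d + suc m ≤ blockEnd (suc d)
    block-long d d<2m = begin
      pivot d + suc m            ≤⟨ +-monoˡ-≤ (suc m) pivot≤ ⟩
      2 * m + K + suc m          ≡⟨ lemma m K ⟩
      suc (3 * m) + K            ≤⟨ +-mono-≤ (t-lower (suc d) d<2m) (<⇒≤ (pivot-above (suc d))) ⟩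
      t (suc d) + pivot (suc d)  ∎
      where
      open ≤-Reasoning
      pivot≤ : pivot d ≤ 2 * m + K
      pivot≤ = ≤-trans (pivot-below d) (+-monoˡ-≤ K (<⇒≤ d<2m))
      lemma : ∀ m k → 2 * m + k + suc m ≡ suc (3 * m) + k
      lemma = solve-∀

    next-block : ∀ d .{{_ : NonZero d}} → suc d ≤ 2 * m →
                 pivot d + (blockEnd (suc d) ∸ pivot d) ≡ blockEnd (suc d)
    next-block d d<2m = m+[n∸m]≡n (m+n≤o⇒m≤o (pivot d) (block-long d d<2m))

    next-block-long : ∀ d .{{_ : NonZero d}} → suc d ≤ 2 * m →
                      suc m ≤ blockEnd (suc d) ∸ pivot d
    next-block-long d d<2m = +-cancelˡ-≤ (pivot d) (suc m) _
      (subst (pivot d + suc m ≤_) (sym (next-block d d<2m)) (block-long d d<2m))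

    turn-from-end : ∀ d .{{_ : NonZero d}} {y} → y ≡ blockEnd d → Step (d , y) (suc d , pivot d)
    turn-from-end d refl = turn (lemma d (t d))
      where
      lemma : ∀ d t → suc d * (d * t) ≡ d * (suc d * t)
      lemma = solve-∀

    fits-after-turn : ∀ {d k} → d + suc k ≤ 2 * m → suc d + k ≤ 2 * m
    fits-after-turn {d} {k} = subst (_≤ 2 * m) (+-suc d k)

    room-to-turn : ∀ {d k} → d + suc k ≤ 2 * m → suc d ≤ 2 * m
    room-to-turn {d} {k} fits = ≤-trans (m≤m+n (suc d) k) (fits-after-turn fits)

    walk-linked : ∀ d .{{_ : NonZero d}} y g k → d + k ≤ 2 * m → y + g ≡ blockEnd d →
                  Linked Step (walk d y g k)
    walk-linked d         y zero    zero    _    _  = [-]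
    walk-linked d@(suc _) y (suc g) k       fits eq =
      along ∷ walk-linked d (suc y) g k fits (trans (sym (+-suc y g)) eq)
    walk-linked d         y zero    (suc k) fits eq =
      turn-from-end d (trans (sym (+-identityʳ y)) eq) ∷
      walk-linked (suc d) (pivot d) _ k (fits-after-turn fits) (next-block d (room-to-turn fits))

    InBand : Point → Set
    InBand (d , y) = K ≤ y × y + d ≤ top

    block-in-band : ∀ d .{{_ : NonZero d}} {y} g → m ≤ d → d ≤ 2 * m → y + g ≡ blockEnd d →
                    K ≤ y → InBand (d , y)
    block-in-band d {y} g m≤d d≤2m eq K≤y =
      K≤y , ≤-trans (+-monoˡ-≤ d (subst (y ≤_) eq (m≤m+n y g))) (blockEnd-bound d m≤d d≤2m)

    walk-in-band : ∀ d .{{_ : NonZero d}} y g k → m ≤ d → d + k ≤ 2 * m →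
                   y + g ≡ blockEnd d → K ≤ y → All InBand (walk d y g k)
    walk-in-band d y zero zero m≤d fits eq K≤y =
      block-in-band d 0 m≤d (≤-trans (m≤m+n d 0) fits) eq K≤y ∷ []
    walk-in-band d y (suc g) k m≤d fits eq K≤y =
      block-in-band d (suc g) m≤d (≤-trans (m≤m+n d k) fits) eq K≤y ∷
      walk-in-band d (suc y) g k m≤d fits (trans (sym (+-suc y g)) eq) (m≤n⇒m≤1+n K≤y)
    walk-in-band d y zero (suc k) m≤d fits eq K≤y =
      block-in-band d 0 m≤d (≤-trans (m≤m+n d (suc k)) fits) eq K≤y ∷
      walk-in-band (suc d) (pivot d) _ k (m≤n⇒m≤1+n m≤d) (fits-after-turn fits)
        (next-block d (room-to-turn fits)) (<⇒≤ (pivot-above d))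

    walk-length : ∀ d .{{_ : NonZero d}} y g k → d + k ≤ 2 * m →
                  suc g + k * (2 + m) ≤ length (walk d y g k)
    walk-length d y zero    zero    _    = ≤-refl
    walk-length d y (suc g) k       fits = s≤s (walk-length d (suc y) g k fits)
    walk-length d y zero    (suc k) fits = s≤s (≤-trans
      (+-monoˡ-≤ (k * (2 + m)) (s≤s (next-block-long d (room-to-turn fits))))
      (walk-length (suc d) (pivot d) _ k (fits-after-turn fits)))

    path-fits : m + m ≤ 2 * m
    path-fits = ≤-reflexive (cong (_+_ m) (sym (+-identityʳ m)))

    path-linked : Linked Step path
    path-linked = walk-linked m (blockEnd m) 0 m path-fits (+-identityʳ _)

    path-in-band : All InBand path
    path-in-band = walk-in-band m (blockEnd m) 0 m ≤-refl path-fits (+-identityʳ _)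
      (≤-trans (<⇒≤ (pivot-above m)) (m≤n+m (pivot m) (t m)))

    path-length : suc m * suc m ≤ length path
    path-length = subst (_≤ length path) (lemma m) (walk-length m (blockEnd m) 0 m path-fits)
      where
      lemma : ∀ m → suc (m * (2 + m)) ≡ suc m * suc m
      lemma = solve-∀

  ConvexDifferences : ℕ → ℕ → Set
  ConvexDifferences n L = ∃[ A ] ∃[ S ]
    (Convex A × length A ≡ n × Convex S × All (InDiffSet A) S × L ≤ length S)

  diagonalWalk-differences : ∀ m .{{_ : NonZero m}} n → suc (10 * m) < n →
                       ConvexDifferences n (suc m * suc m)
  diagonalWalk-differences m n n-large =
    cubicImage H K n , map (+_ ∘ difference H) path ,
    cubicImage-convex H K n , length-cubicImage H K n ,
    convex-map (difference H) (difference-< H ∘ band⇒small) (difference-midpoint H ∘ band⇒small)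
      path-in-band path-linked ,
    All.map⁺ (All.map band⇒differences path-in-band) ,
    subst (suc m * suc m ≤_) (sym (length-map _ path)) path-length
    where
    open DiagonalWalk m
    H : ℕ
    H = suc (top * top * top + top * top * top)

    band⇒small : ∀ {p} → InBand p → Small H p
    band⇒small {d , y} (_ , y+d≤top) = s≤s (+-mono-≤ c≤ c≤)
      where
      c≤ : cubicPart (d , y) ≤ top * top * top
      c≤ = ≤-trans (cubicPart-≤ d y) (*-mono-≤ (*-mono-≤ y+d≤top y+d≤top) y+d≤top)

    band⇒differences : ∀ {p} → InBand p → InDiffSet (cubicImage H K n) (+ difference H p)
    band⇒differences (K≤y , y+d≤top) =
      inDiffSet-difference H K≤y (≤-<-trans y+d≤top (+-monoʳ-< K n-large))

  singleton-differences : ∀ n → 0 < n → ConvexDifferences n 1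
  singleton-differences n 0<n =
    cubicImage 0 0 n , + 0 ∷ [] , cubicImage-convex 0 0 n , length-cubicImage 0 0 n ,
    (tt , tt) , inDiffSet-zero (∈-cubicImage 0 z≤n 0<n) ∷ [] , ≤-refl

  quadratic-differences : ∀ n → ∃[ L ] (n * n ≤ 144 * L × ConvexDifferences n L)
  quadratic-differences zero = 0 , z≤n , [] , [] , (tt , tt) , refl , (tt , tt) , [] , z≤n
  quadratic-differences n@(suc _) = by-quotient (n / 12) n<12[1+n/12] 12[n/12]≤n
    where
    n<12[1+n/12] : n < 12 * suc (n / 12)
    n<12[1+n/12] = begin-strict
      n                     ≡⟨ m≡m%n+[m/n]*n n 12 ⟩
      n % 12 + n / 12 * 12  <⟨ +-monoˡ-< (n / 12 * 12) (m%n<n n 12) ⟩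
      12 + n / 12 * 12      ≡⟨ cong (_+_ 12) (*-comm (n / 12) 12) ⟩
      12 + 12 * (n / 12)    ≡⟨ *-suc 12 (n / 12) ⟨
      12 * suc (n / 12)     ∎
      where open ≤-Reasoning

    12[n/12]≤n : 12 * (n / 12) ≤ n
    12[n/12]≤n = subst (_≤ n) (*-comm (n / 12) 12) (m/n*n≤m n 12)

    square-bound : ∀ q → n < 12 * suc q → n * n ≤ 144 * (suc q * suc q)
    square-bound q n<12[1+q] = subst (n * n ≤_) (lemma q) (*-mono-≤ n≤12[1+q] n≤12[1+q])
      where
      n≤12[1+q] : n ≤ 12 * suc q
      n≤12[1+q] = <⇒≤ n<12[1+q]
      lemma : ∀ q → 12 * suc q * (12 * suc q) ≡ 144 * (suc q * suc q)
      lemma = solve-∀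

    large : ∀ q → 12 * suc q ≤ n → suc (10 * suc q) < n
    large q 12[1+q]≤n = ≤-trans (≤-trans (m≤m+n _ (2 * q)) (≤-reflexive (lemma q))) 12[1+q]≤n
      where
      lemma : ∀ q → suc (suc (10 * suc q)) + 2 * q ≡ 12 * suc q
      lemma = solve-∀

    by-quotient : ∀ q → n < 12 * suc q → 12 * q ≤ n →
                  ∃[ L ] (n * n ≤ 144 * L × ConvexDifferences n L)
    by-quotient zero    n<12 _ = 1 , square-bound 0 n<12 , singleton-differences n z<s
    by-quotient (suc q) n<12[2+q] 12[1+q]≤n =
      suc (suc q) * suc (suc q) , square-bound (suc q) n<12[2+q] ,
      diagonalWalk-differences (suc q) n (large q 12[1+q]≤n)

open import Data.Nat using (ℕ)
open import Data.Integer using (+_)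
open import Data.List using (List; length)
open import Data.List.Relation.Unary.All using (All)
open import Data.Product using (_×_; ∃-syntax)
open import Relation.Binary.PropositionalEquality using (_≡_)
open import Data.Rational using (ℚ; Positive; _≤_; _*_; _/_)

import Data.Nat as ℕ
import Data.Nat.Properties as ℕ
import Data.Integer as ℤ
import Data.Integer.Properties as ℤ
open import Data.Product using (_,_)
open import Data.Rational using (toℚᵘ)
open import Data.Rational.Properties using (toℚᵘ-cancel-≤; toℚᵘ-homo-*; toℚᵘ-fromℚᵘ)
open import Data.Rational.Unnormalised as ℚᵘ using (mkℚᵘ; *≤*)
import Data.Rational.Unnormalised.Properties as ℚᵘ
open import Relation.Binary.PropositionalEquality using (sym; trans; cong; subst₂)

n²≤cL⇒n²/c≤L : ∀ c-1 n L → n ℕ.* n ℕ.≤ ℕ.suc c-1 ℕ.* L →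
               + 1 / ℕ.suc c-1 * ((+ n / 1) * (+ n / 1)) ≤ + L / 1
n²≤cL⇒n²/c≤L c-1 n L n²≤cL = toℚᵘ-cancel-≤ (begin
  toℚᵘ (1/c * (n/1 * n/1))
    ≃⟨ toℚᵘ-homo-* 1/c (n/1 * n/1) ⟩
  toℚᵘ 1/c ℚᵘ.* toℚᵘ (n/1 * n/1)
    ≃⟨ ℚᵘ.*-cong (toℚᵘ-fromℚᵘ (mkℚᵘ (+ 1) c-1))
         (ℚᵘ.≃-trans (toℚᵘ-homo-* n/1 n/1) (ℚᵘ.*-cong n/1≃n n/1≃n)) ⟩
  mkℚᵘ (+ 1) c-1 ℚᵘ.* (mkℚᵘ (+ n) 0 ℚᵘ.* mkℚᵘ (+ n) 0)
    ≤⟨ *≤* (subst₂ ℤ._≤_ numerators denominators (ℤ.+≤+ n²≤cL)) ⟩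
  mkℚᵘ (+ L) 0
    ≃⟨ toℚᵘ-fromℚᵘ (mkℚᵘ (+ L) 0) ⟨
  toℚᵘ (+ L / 1) ∎)
  where
  open ℚᵘ.≤-Reasoning
  1/c n/1 : ℚ
  1/c = + 1 / ℕ.suc c-1
  n/1 = + n / 1
  n/1≃n : toℚᵘ n/1 ℚᵘ.≃ mkℚᵘ (+ n) 0
  n/1≃n = toℚᵘ-fromℚᵘ (mkℚᵘ (+ n) 0)
  numerators : + (n ℕ.* n) ≡ (+ 1 ℤ.* (+ n ℤ.* + n)) ℤ.* + 1
  numerators = sym (trans (ℤ.*-identityʳ _) (trans (ℤ.*-identityˡ _) (sym (ℤ.pos-* n n))))
  denominators : + (ℕ.suc c-1 ℕ.* L) ≡ + L ℤ.* + ℕ.suc (c-1 ℕ.* 1)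
  denominators = trans (cong +_ (trans (ℕ.*-comm (ℕ.suc c-1) L)
    (cong (λ k → L ℕ.* ℕ.suc k) (sym (ℕ.*-identityʳ c-1))))) (ℤ.pos-* L _)

theorem1 : ∃[ C ] (Positive C × ((n : ℕ) → ∃[ A ] ∃[ S ]
    (Convex A × length A ≡ n × Convex S × All (InDiffSet A) S
    × C * ((+ n / 1) * (+ n / 1)) ≤ + length S / 1)))
theorem1 = + 1 / 144 , _ , λ n →
  let L , n²≤144L , A , S , convex-A , length-A , convex-S , S⊆A−A , L≤∣S∣ =
        quadratic-differences n
  in  A , S , convex-A , length-A , convex-S , S⊆A−A ,
      n²≤cL⇒n²/c≤L 143 n (length S) (ℕ.≤-trans n²≤144L (ℕ.*-monoʳ-≤ 144 L≤∣S∣))
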